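{- Let $T$ be a finitary monad on $\mathsf{Set}$ and let $\mathcal{A}=\mathsf{Set}^T$ be its category of Eilenberg–Moore algebras. Let $F:\mathcal{A}\to\mathcal{A}$ be a finitary endofunctor that preserves surjective $T$-algebra morphisms. Then the full subcategory $\mathsf{Coalg}_{\mathrm{ffg}}F$ of $\mathsf{Coalg}\,F$ is closed under finite coproducts in $\mathsf{Coalg}\,F$, i.e. it contains an initial object of $\mathsf{Coalg}\,F$ and, for any two of its objects, their coproduct formed in $\mathsf{Coalg}\,F$ is (isomorphic to) an object of $\mathsf{Coalg}_{\mathrm{ffg}}F$.
   Context: $\mathsf{Coalg}\,F$ denotes the category of $F$-coalgebras $c:C\to FC$ and coalgebra morphisms. For a set $X$, $(TX,\mu_X)$ is the free $T$-algebra on $X$. $\mathsf{Coalg}_{\mathrm{ffg}}F$ is the full subcategory of $\mathsf{Coalg}\,F$ consisting of all coalgebras $c:TX\to FTX$ whose carrier is a free $T$-algebra $TX$ on a finite set $X$. A functor is finitary if it preserves filtered colimits. -}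

module Defs where

open import Data.Nat using (ℕ)
open import Data.Fin using (Fin)
open import Data.Product using (Σ; _×_; _,_; ∃)
open import Function using (_∘′_)
open import Function.Bundles using (_↔_)
open import Relation.Binary.PropositionalEquality

-- Pointwise equality of functions (no function extensionality in --safe)

_≐_ : {A B : Set} → (A → B) → (A → B) → Set
f ≐ g = ∀ x → f x ≡ g x

infix 4 _≐_

record Cat : Set₂ where
  field
    Obj  : Set₁
    Hom  : Obj → Obj → Set
    _≈_  : ∀ {a b} → Hom a b → Hom a b → Set
    idC  : ∀ {a} → Hom a a
    _∘C_ : ∀ {a b c} → Hom b c → Hom a b → Hom a c
    ≈-refl  : ∀ {a b} {f : Hom a b} → f ≈ f
    ≈-sym   : ∀ {a b} {f g : Hom a b} → f ≈ g → g ≈ f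
    ≈-trans : ∀ {a b} {f g h : Hom a b} → f ≈ g → g ≈ h → f ≈ h
    ∘-cong  : ∀ {a b c} {f f' : Hom b c} {g g' : Hom a b} →
              f ≈ f' → g ≈ g' → (f ∘C g) ≈ (f' ∘C g')

SetCat : Cat
SetCat = record
  { Obj = Set ; Hom = λ A B → A → B ; _≈_ = _≐_
  ; idC = λ x → x ; _∘C_ = λ g f x → g (f x)
  ; ≈-refl = λ _ → refl ; ≈-sym = λ p x → sym (p x)
  ; ≈-trans = λ p q x → trans (p x) (q x)
  ; ∘-cong = λ {_} {_} {_} {f} {f'} {g} {g'} p q x → trans (cong f (q x)) (p (g' x)) }

record SmallCat : Set₁ where
  field
    Ob   : Set
    Arr  : Ob → Ob → Set
    ida  : ∀ {i} → Arr i i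
    _·_  : ∀ {i j k} → Arr j k → Arr i j → Arr i k
    idˡ  : ∀ {i j} (f : Arr i j) → ida · f ≡ f
    idʳ  : ∀ {i j} (f : Arr i j) → f · ida ≡ f
    assoc : ∀ {i j k l} (h : Arr k l) (g : Arr j k) (f : Arr i j) →
            (h · g) · f ≡ h · (g · f)

record Filtered (J : SmallCat) : Set where
  open SmallCat J
  field
    nonempty : Ob
    upper    : ∀ i j → Σ Ob λ k → Arr i k × Arr j k
    coequal  : ∀ {i j} (f g : Arr i j) →
               Σ Ob λ k → Σ (Arr j k) λ h → h · f ≡ h · g

module _ (C : Cat) (J : SmallCat) where
  open Cat C
  open SmallCat J

  record Diagram : Set₁ where
    field
      D₀    : Ob → Obj
      D₁    : ∀ {i j} → Arr i j → Hom (D₀ i) (D₀ j)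
      D-id  : ∀ {i} → D₁ (ida {i}) ≈ idC
      D-∘   : ∀ {i j k} (g : Arr j k) (f : Arr i j) → D₁ (g · f) ≈ (D₁ g ∘C D₁ f)

  record Cocone (D : Diagram) : Set₁ where
    open Diagram D
    field
      apex : Obj
      leg  : ∀ i → Hom (D₀ i) apex
      comm : ∀ {i j} (f : Arr i j) → (leg j ∘C D₁ f) ≈ leg i

  record IsColimit {D : Diagram} (K : Cocone D) : Set₁ where
    open Cocone
    field
      mediate   : (K' : Cocone D) → Hom (apex K) (apex K')
      factors   : (K' : Cocone D) → ∀ i → (mediate K' ∘C leg K i) ≈ leg K' i
      unique    : (K' : Cocone D) (u : Hom (apex K) (apex K')) →
                  (∀ i → (u ∘C leg K i) ≈ leg K' i) → u ≈ mediate K'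

record Functor (C D : Cat) : Set₂ where
  private module C = Cat C
  private module D = Cat D
  field
    F₀     : C.Obj → D.Obj
    F₁     : ∀ {a b} → C.Hom a b → D.Hom (F₀ a) (F₀ b)
    F-cong : ∀ {a b} {f g : C.Hom a b} → f C.≈ g → F₁ f D.≈ F₁ g
    F-id   : ∀ {a} → F₁ (C.idC {a}) D.≈ D.idC
    F-∘    : ∀ {a b c} (g : C.Hom b c) (f : C.Hom a b) →
             F₁ (g C.∘C f) D.≈ (F₁ g D.∘C F₁ f)

module _ {C D : Cat} (F : Functor C D) where
  open Functor F
  private module C = Cat C
  private module D = Cat D

  mapDiagram : ∀ {J} → Diagram C J → Diagram D J
  mapDiagram {J} Δ = record
    { D₀ = λ i → F₀ (Δ.D₀ i)
    ; D₁ = λ f → F₁ (Δ.D₁ f)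
    ; D-id = D.≈-trans (F-cong Δ.D-id) F-id
    ; D-∘ = λ g f → D.≈-trans (F-cong (Δ.D-∘ g f)) (F-∘ _ _) }
    where module Δ = Diagram Δ

  mapCocone : ∀ {J} {Δ : Diagram C J} → Cocone C J Δ → Cocone D J (mapDiagram Δ)
  mapCocone K = record
    { apex = F₀ (K.apex)
    ; leg = λ i → F₁ (K.leg i)
    ; comm = λ f → D.≈-trans (D.≈-sym (F-∘ _ _)) (F-cong (K.comm f)) }
    where module K = Cocone K

  Finitary : Set₁
  Finitary = (J : SmallCat) → Filtered J → (Δ : Diagram C J) (K : Cocone C J Δ) →
             IsColimit C J K → IsColimit D J (mapCocone K)

record Monad : Set₁ where
  field
    T      : Set → Set
    map    : ∀ {A B : Set} → (A → B) → T A → T B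
    η      : ∀ {A : Set} → A → T A
    μ      : ∀ {A : Set} → T (T A) → T A
    map-cong : ∀ {A B} {f g : A → B} → f ≐ g → map f ≐ map g
    map-id : ∀ {A} → map (λ (x : A) → x) ≐ (λ x → x)
    map-∘  : ∀ {A B C} (g : B → C) (f : A → B) → map (λ x → g (f x)) ≐ (λ x → map g (map f x))
    η-nat  : ∀ {A B} (f : A → B) → (λ x → η (f x)) ≐ (λ x → map f (η x))
    μ-nat  : ∀ {A B} (f : A → B) → (λ x → μ (map (map f) x)) ≐ (λ x → map f (μ x))
    μ-η    : ∀ {A} → (λ (x : T A) → μ (η x)) ≐ (λ x → x)
    μ-mapη : ∀ {A} → (λ (x : T A) → μ (map η x)) ≐ (λ x → x)
    μ-μ    : ∀ {A} → (λ (x : T (T (T A))) → μ (μ x)) ≐ (λ x → μ (map μ x))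

  TFunctor : Functor SetCat SetCat
  TFunctor = record
    { F₀ = T ; F₁ = map ; F-cong = map-cong ; F-id = map-id ; F-∘ = map-∘ }

module _ (M : Monad) where
  open Monad M

  record Alg : Set₁ where
    field
      Carrier : Set
      act     : T Carrier → Carrier
      act-η   : (λ x → act (η x)) ≐ (λ x → x)
      act-μ   : (λ x → act (μ x)) ≐ (λ x → act (map act x))

  open Alg

  record AlgHom (A B : Alg) : Set where
    field
      fun : Carrier A → Carrier B
      hom : (λ x → fun (act A x)) ≐ (λ x → act B (map fun x))

  open AlgHom

  idAlgHom : ∀ {A} → AlgHom A A
  idAlgHom {A} = record { fun = λ x → x ; hom = λ x → cong (act A) (sym (map-id x)) }

  _∘A_ : ∀ {A B C} → AlgHom B C → AlgHom A B → AlgHom A C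
  _∘A_ {A} {B} {C} g f = record
    { fun = λ x → fun g (fun f x)
    ; hom = λ x → trans (cong (fun g) (hom f x))
                  (trans (hom g (map (fun f) x))
                         (cong (act C) (sym (map-∘ (fun g) (fun f) x)))) }

  AlgCat : Cat
  AlgCat = record
    { Obj = Alg ; Hom = AlgHom ; _≈_ = λ f g → fun f ≐ fun g
    ; idC = idAlgHom ; _∘C_ = _∘A_
    ; ≈-refl = λ _ → refl ; ≈-sym = λ p x → sym (p x)
    ; ≈-trans = λ p q x → trans (p x) (q x)
    ; ∘-cong = λ {_} {_} {_} {f} {f'} {g} {g'} p q x →
                 trans (cong (fun f) (q x)) (p (fun g' x)) }

  Free : Set → Alg
  Free X = record { Carrier = T X ; act = μ ; act-η = μ-η ; act-μ = μ-μ }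

  Surjective : ∀ {A B} → AlgHom A B → Set
  Surjective {A} {B} h = ∀ (y : Carrier B) → Σ (Carrier A) λ x → fun h x ≡ y

  Endo : Set₂
  Endo = Functor AlgCat AlgCat

  PreservesSurjections : Endo → Set₁
  PreservesSurjections F = ∀ {A B} (h : AlgHom A B) → Surjective h → Surjective (Functor.F₁ F h)

  IsFinite : Set → Set
  IsFinite X = Σ ℕ λ n → X ↔ Fin n

  module _ (F : Endo) where
    open Functor F
    private module A = Cat AlgCat

    record Coalg : Set₁ where
      field
        carrier : Alg
        str     : AlgHom carrier (F₀ carrier)

    open Coalg

    record CoalgHom (C D : Coalg) : Set where
      field
        mor  : AlgHom (carrier C) (carrier D)
        comm : (str D ∘A mor) A.≈ (F₁ mor ∘A str C)

    open CoalgHom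

    _∘Co_ : ∀ {C D E} → CoalgHom D E → CoalgHom C D → AlgHom (carrier C) (carrier E)
    g ∘Co f = mor g ∘A mor f

    IsInitial : Coalg → Set₁
    IsInitial I = (C : Coalg) → Σ (CoalgHom I C) λ u →
                  (v : CoalgHom I C) → mor v A.≈ mor u

    IsCoproduct : (C₁ C₂ P : Coalg) → CoalgHom C₁ P → CoalgHom C₂ P → Set₁
    IsCoproduct C₁ C₂ P i₁ i₂ =
      (E : Coalg) (f : CoalgHom C₁ E) (g : CoalgHom C₂ E) →
      Σ (CoalgHom P E) λ u →
        ((u ∘Co i₁) A.≈ mor f) × ((u ∘Co i₂) A.≈ mor g) ×
        ((v : CoalgHom P E) → (v ∘Co i₁) A.≈ mor f → (v ∘Co i₂) A.≈ mor g →
           mor v A.≈ mor u)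

    record FfgCoalg : Set₁ where
      field
        X      : Set
        finite : IsFinite X
        c      : AlgHom (Free X) (F₀ (Free X))

    toCoalg : FfgCoalg → Coalg
    toCoalg C = record { carrier = Free (FfgCoalg.X C) ; str = FfgCoalg.c C }

module Submission where

open import Defs
open import Data.Fin using (Fin)
open import Data.Fin.Properties using (+↔⊎)
open import Data.Nat using (_+_)
open import Data.Product using (Σ; _×_; _,_)
open import Data.Sum using (_⊎_; inj₁; inj₂; [_,_]′)
open import Data.Sum.Function.Propositional using (_⊎-↔_)
open import Function.Properties.Inverse using (↔-refl; ↔-sym; ↔-trans)
open import Function using (_∘′_)
open import Relation.Binary.PropositionalEquality using (_≡_; sym; trans; cong; module ≡-Reasoning)
open ≡-Reasoning

record Initial (C : Cat) : Set₁ where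
  open Cat C
  field
    ⊥        : Obj
    ¡        : ∀ {A} → Hom ⊥ A
    ¡-unique : ∀ {A} (f : Hom ⊥ A) → f ≈ ¡

record Coproduct (C : Cat) (A B : Cat.Obj C) : Set₁ where
  open Cat C
  field
    A+B     : Obj
    i₁      : Hom A A+B
    i₂      : Hom B A+B
    [_,_]   : ∀ {E} → Hom A E → Hom B E → Hom A+B E
    inject₁ : ∀ {E} {f : Hom A E} {g : Hom B E} → ([ f , g ] ∘C i₁) ≈ f
    inject₂ : ∀ {E} {f : Hom A E} {g : Hom B E} → ([ f , g ] ∘C i₂) ≈ g
    unique  : ∀ {E} {h : Hom A+B E} {f : Hom A E} {g : Hom B E} →
              (h ∘C i₁) ≈ f → (h ∘C i₂) ≈ g → h ≈ [ f , g ]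

  jointly-epic : ∀ {E} {h k : Hom A+B E} →
                 (h ∘C i₁) ≈ (k ∘C i₁) → (h ∘C i₂) ≈ (k ∘C i₂) → h ≈ k
  jointly-epic p q = ≈-trans (unique p q) (≈-sym (unique ≈-refl ≈-refl))

module FreeAlgebra (M : Monad) where
  open Monad M
  open Alg
  open AlgHom
  private
    module 𝒜 = Cat (AlgCat M)
    _∘_ : ∀ {A B C} → AlgHom M B C → AlgHom M A B → AlgHom M A C
    _∘_ = _∘A_ M

  extend : ∀ {X} {B : Alg M} → (X → Carrier B) → AlgHom M (Free M X) B
  extend {B = B} h = record
    { fun = λ t → act B (map h t)
    ; hom = λ t → begin
        act B (map h (μ t))                   ≡⟨ cong (act B) (sym (μ-nat h t)) ⟩
        act B (μ (map (map h) t))             ≡⟨ act-μ B (map (map h) t) ⟩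
        act B (map (act B) (map (map h) t))   ≡⟨ cong (act B) (sym (map-∘ (act B) (map h) t)) ⟩
        act B (map (λ s → act B (map h s)) t) ∎ }

  extend-η : ∀ {X} {B : Alg M} (h : X → Carrier B) (x : X) →
             fun (extend {B = B} h) (η x) ≡ h x
  extend-η {B = B} h x = trans (cong (act B) (sym (η-nat h x))) (act-η B (h x))

  free-expand : ∀ {X} {B : Alg M} (f : AlgHom M (Free M X) B) (t : T X) →
                fun f t ≡ act B (map (λ x → fun f (η x)) t)
  free-expand {B = B} f t = begin
    fun f t                           ≡⟨ cong (fun f) (sym (μ-mapη t)) ⟩
    fun f (μ (map η t))               ≡⟨ hom f (map η t) ⟩
    act B (map (fun f) (map η t))     ≡⟨ cong (act B) (sym (map-∘ (fun f) η t)) ⟩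
    act B (map (λ x → fun f (η x)) t) ∎

  free-unique : ∀ {X} {B : Alg M} (f g : AlgHom M (Free M X) B) →
                (λ x → fun f (η x)) ≐ (λ x → fun g (η x)) → f 𝒜.≈ g
  free-unique {B = B} f g p t = begin
    fun f t                            ≡⟨ free-expand f t ⟩
    act B (map (λ x → fun f (η x)) t)  ≡⟨ cong (act B) (map-cong p t) ⟩
    act B (map (λ x → fun g (η x)) t)  ≡⟨ sym (free-expand g t) ⟩
    fun g t                            ∎

  free-initial : Initial (AlgCat M)
  free-initial = record
    { ⊥        = Free M (Fin 0)
    ; ¡        = extend (λ ())
    ; ¡-unique = λ f → free-unique f (extend (λ ())) (λ ()) }

  free-coproduct : ∀ {X Y} → Coproduct (AlgCat M) (Free M X) (Free M Y)
  free-coproduct {X} {Y} = record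
    { A+B     = Free M (X ⊎ Y)
    ; i₁      = ι₁
    ; i₂      = ι₂
    ; [_,_]   = copair
    ; inject₁ = λ {_} {f} {g} → free-unique (copair f g ∘ ι₁) f λ x →
                  trans (cong (fun (copair f g)) (ι₁-η x)) (copair-η f g (inj₁ x))
    ; inject₂ = λ {_} {f} {g} → free-unique (copair f g ∘ ι₂) g λ y →
                  trans (cong (fun (copair f g)) (ι₂-η y)) (copair-η f g (inj₂ y))
    ; unique  = λ {_} {h} {f} {g} p q → free-unique h (copair f g) λ
        { (inj₁ x) → trans (cong (fun h) (sym (ι₁-η x)))
                           (trans (p (η x)) (sym (copair-η f g (inj₁ x))))
        ; (inj₂ y) → trans (cong (fun h) (sym (ι₂-η y)))
                           (trans (q (η y)) (sym (copair-η f g (inj₂ y)))) } }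
    where
      ι₁ : AlgHom M (Free M X) (Free M (X ⊎ Y))
      ι₁ = extend (η ∘′ inj₁)
      ι₂ : AlgHom M (Free M Y) (Free M (X ⊎ Y))
      ι₂ = extend (η ∘′ inj₂)
      generators : ∀ {E} → AlgHom M (Free M X) E → AlgHom M (Free M Y) E →
                   X ⊎ Y → Carrier E
      generators f g = [ (λ x → fun f (η x)) , (λ y → fun g (η y)) ]′
      copair : ∀ {E} → AlgHom M (Free M X) E → AlgHom M (Free M Y) E →
               AlgHom M (Free M (X ⊎ Y)) E
      copair f g = extend (generators f g)
      ι₁-η : (x : X) → fun ι₁ (η x) ≡ η (inj₁ x)
      ι₁-η = extend-η {B = Free M (X ⊎ Y)} (η ∘′ inj₁)
      ι₂-η : (y : Y) → fun ι₂ (η y) ≡ η (inj₂ y)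
      ι₂-η = extend-η {B = Free M (X ⊎ Y)} (η ∘′ inj₂)
      copair-η : ∀ {E} (f : AlgHom M (Free M X) E) (g : AlgHom M (Free M Y) E) →
                 (z : X ⊎ Y) → fun (copair f g) (η z) ≡ generators f g z
      copair-η {E} f g = extend-η {B = E} (generators f g)

module CoalgebraColimits (M : Monad) (F : Endo M) where
  open Functor F
  open AlgHom
  open Coalg
  open CoalgHom
  private
    module 𝒜 = Cat (AlgCat M)
    _∘_ : ∀ {A B C} → AlgHom M B C → AlgHom M A B → AlgHom M A C
    _∘_ = _∘A_ M

  initial-coalg : Initial (AlgCat M) → Coalg M F
  initial-coalg I = record { carrier = ⊥ ; str = ¡ }
    where open Initial I

  initial-coalg-isInitial : (I : Initial (AlgCat M)) → IsInitial M F (initial-coalg I)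
  initial-coalg-isInitial I C = ¡C , λ v → ¡-unique (mor v)
    where
      open Initial I
      ¡C : CoalgHom M F (initial-coalg I) C
      ¡C = record
        { mor  = ¡
        ; comm = λ x → trans (¡-unique {F₀ (carrier C)} (str C ∘ ¡) x)
                             (sym (¡-unique (F₁ (¡ {carrier C}) ∘ ¡) x)) }

  square-along : {C P E : Coalg M F} (j : CoalgHom M F C P) (f : CoalgHom M F C E)
                 (h : AlgHom M (carrier P) (carrier E)) → (h ∘ mor j) 𝒜.≈ mor f →
                 ((str E ∘ h) ∘ mor j) 𝒜.≈ ((F₁ h ∘ str P) ∘ mor j)
  square-along {C} {P} {E} j f h hj≈f x = begin
    fun (str E) (fun h (fun (mor j) x))           ≡⟨ cong (fun (str E)) (hj≈f x) ⟩
    fun (str E) (fun (mor f) x)                   ≡⟨ comm f x ⟩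
    fun (F₁ (mor f)) (fun (str C) x)              ≡⟨ F-cong (λ y → sym (hj≈f y)) (fun (str C) x) ⟩
    fun (F₁ (h ∘ mor j)) (fun (str C) x)          ≡⟨ F-∘ h (mor j) (fun (str C) x) ⟩
    fun (F₁ h) (fun (F₁ (mor j)) (fun (str C) x)) ≡⟨ cong (fun (F₁ h)) (sym (comm j x)) ⟩
    fun (F₁ h) (fun (str P) (fun (mor j) x))      ∎

  module _ (C₁ C₂ : Coalg M F) (P : Coproduct (AlgCat M) (carrier C₁) (carrier C₂)) where
    open Coproduct P

    coproduct-coalg : Coalg M F
    coproduct-coalg = record { carrier = A+B ; str = [ F₁ i₁ ∘ str C₁ , F₁ i₂ ∘ str C₂ ] }

    inject₁-coalg : CoalgHom M F C₁ coproduct-coalg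
    inject₁-coalg = record { mor = i₁ ; comm = inject₁ {g = F₁ i₂ ∘ str C₂} }

    inject₂-coalg : CoalgHom M F C₂ coproduct-coalg
    inject₂-coalg = record { mor = i₂ ; comm = inject₂ {f = F₁ i₁ ∘ str C₁} }

    copair-coalg : ∀ {E} → CoalgHom M F C₁ E → CoalgHom M F C₂ E →
                   CoalgHom M F coproduct-coalg E
    copair-coalg {E} f g = record
      { mor  = [ mor f , mor g ]
      ; comm = jointly-epic {h = str E ∘ [ mor f , mor g ]}
                            {k = F₁ [ mor f , mor g ] ∘ str coproduct-coalg}
                            (square-along inject₁-coalg f [ mor f , mor g ] (inject₁ {g = mor g}))
                            (square-along inject₂-coalg g [ mor f , mor g ] (inject₂ {f = mor f})) }

    coproduct-coalg-isCoproduct :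
      IsCoproduct M F C₁ C₂ coproduct-coalg inject₁-coalg inject₂-coalg
    coproduct-coalg-isCoproduct E f g =
      copair-coalg f g , inject₁ {g = mor g} , inject₂ {f = mor f} ,
      λ v p q → unique {h = mor v} p q

IsFinite-⊎ : (M : Monad) {X Y : Set} → IsFinite M X → IsFinite M Y → IsFinite M (X ⊎ Y)
IsFinite-⊎ M (m , X↔m) (n , Y↔n) = m + n , ↔-trans (X↔m ⊎-↔ Y↔n) (↔-sym +↔⊎)

lemma3p6 : (M : Monad) → Finitary (Monad.TFunctor M) →
    (F : Endo M) → Finitary F → PreservesSurjections M F →
    Σ (FfgCoalg M F) (λ I → IsInitial M F (toCoalg M F I)) ×
    ((C₁ C₂ : FfgCoalg M F) → Σ (FfgCoalg M F) λ P →
    Σ (CoalgHom M F (toCoalg M F C₁) (toCoalg M F P)) λ i₁ →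
    Σ (CoalgHom M F (toCoalg M F C₂) (toCoalg M F P)) λ i₂ →
    IsCoproduct M F (toCoalg M F C₁) (toCoalg M F C₂) (toCoalg M F P) i₁ i₂)
lemma3p6 M _ F _ _ =
  (initial-ffg , initial-coalg-isInitial free-initial) ,
  λ C₁ C₂ → coproduct-ffg C₁ C₂ ,
            inject₁-coalg (toCoalg M F C₁) (toCoalg M F C₂) free-coproduct ,
            inject₂-coalg (toCoalg M F C₁) (toCoalg M F C₂) free-coproduct ,
            coproduct-coalg-isCoproduct (toCoalg M F C₁) (toCoalg M F C₂) free-coproduct
  where
    open FreeAlgebra M
    open CoalgebraColimits M F
    open FfgCoalg
    open Coalg

    initial-ffg : FfgCoalg M F
    initial-ffg = record
      { X = Fin 0 ; finite = 0 , ↔-refl ; c = str (initial-coalg free-initial) }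

    coproduct-ffg : FfgCoalg M F → FfgCoalg M F → FfgCoalg M F
    coproduct-ffg C₁ C₂ = record
      { X      = X C₁ ⊎ X C₂
      ; finite = IsFinite-⊎ M (finite C₁) (finite C₂)
      ; c      = str (coproduct-coalg (toCoalg M F C₁) (toCoalg M F C₂) free-coproduct) }
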